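{- Let $S\subseteq\mathbb{Z}^2$ be an antimatroidal point set. Then $S=\{X\cup Y: X\in\mathcal{B}_{lower},\ Y\in\mathcal{B}_{upper}\}$, where $X\cup Y=(\max(x_X,x_Y),\max(y_X,y_Y))$.
   Context: A point $A=(x_A,y_A)\in\mathbb{Z}^2$ is regarded as a multiset over $\{x,y\}$; $A\subseteq B$ means $x_A\le x_B$ and $y_A\le y_B$; $A\cup B=(\max(x_A,x_B),\max(y_A,y_B))$. A finite nonempty set $S\subseteq\mathbb{Z}^2$ is an antimatroidal point set if (A1) for every $(x_A,y_A)\in S$ with $(x_A,y_A)\neq(0,0)$, either $(x_A-1,y_A)\in S$ or $(x_A,y_A-1)\in S$; (A2) for all $A,B\in S$ with $A\not\subseteq B$: if $x_A\ge x_B$ and $y_A\ge y_B$ then $(x_B+1,y_B)\in S$ or $(x_B,y_B+1)\in S$; if $x_A\le x_B$ and $y_A\ge y_B$ then $(x_B,y_B+1)\in S$; if $x_A\ge x_B$ and $y_A\le y_B$ then $(x_B+1,y_B)\in S$. $\mathcal{B}_{lower}=\{(x,y)\in S:(x+1,y)\notin S\ \vee\ (x,y-1)\notin S\ \vee\ (x+1,y-1)\notin S\}$, $\mathcal{B}_{upper}=\{(x,y)\in S:(x-1,y)\notin S\ \vee\ (x,y+1)\notin S\ \vee\ (x-1,y+1)\notin S\}$. -}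

module Defs where

open import Data.Integer using (ℤ; 0ℤ; 1ℤ; _+_; _-_; _≤_; _⊔_)
open import Data.Product using (_×_; _,_; proj₁; proj₂; ∃; ∃-syntax)
open import Data.Sum using (_⊎_)
open import Data.List using (List; [])
open import Data.List.Membership.Propositional using (_∈_; _∉_)
open import Relation.Nullary using (¬_)
open import Relation.Binary.PropositionalEquality using (_≡_; _≢_)

Point : Set
Point = ℤ × ℤ

-- A ⊆ B as multisets over {x,y}
_⊆ₚ_ : Point → Point → Set
(xa , ya) ⊆ₚ (xb , yb) = (xa ≤ xb) × (ya ≤ yb)

_∪ₚ_ : Point → Point → Point
(xa , ya) ∪ₚ (xb , yb) = (xa ⊔ xb , ya ⊔ yb)

-- A finite point set is represented by a list of its points (duplicates harmless).
PointSet : Set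
PointSet = List Point

A1 : PointSet → Set
A1 S = ∀ (x y : ℤ) → (x , y) ∈ S → (x , y) ≢ (0ℤ , 0ℤ) →
       ((x - 1ℤ , y) ∈ S) ⊎ ((x , y - 1ℤ) ∈ S)

A2 : PointSet → Set
A2 S = ∀ (xa ya xb yb : ℤ) → (xa , ya) ∈ S → (xb , yb) ∈ S →
       ¬ ((xa , ya) ⊆ₚ (xb , yb)) →
       ((xb ≤ xa → yb ≤ ya → ((xb + 1ℤ , yb) ∈ S) ⊎ ((xb , yb + 1ℤ) ∈ S))
      × (xa ≤ xb → yb ≤ ya → (xb , yb + 1ℤ) ∈ S)
      × (xb ≤ xa → ya ≤ yb → (xb + 1ℤ , yb) ∈ S))

IsAntimatroidal : PointSet → Set
IsAntimatroidal S = (S ≢ []) × A1 S × A2 S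

Blower : PointSet → Point → Set
Blower S (x , y) = ((x , y) ∈ S) ×
  (((x + 1ℤ , y) ∉ S) ⊎ ((x , y - 1ℤ) ∉ S) ⊎ ((x + 1ℤ , y - 1ℤ) ∉ S))

Bupper : PointSet → Point → Set
Bupper S (x , y) = ((x , y) ∈ S) ×
  (((x - 1ℤ , y) ∉ S) ⊎ ((x , y + 1ℤ) ∉ S) ⊎ ((x - 1ℤ , y + 1ℤ) ∉ S))

module Submission where

open import Defs
open import Data.Product using (_×_; _,_; ∃; ∃-syntax; proj₁; proj₂)
open import Data.List.Membership.Propositional using (_∈_)
open import Relation.Binary.PropositionalEquality using (_≡_)

open import Data.Nat using (zero; suc)
import Data.Nat.Properties as ℕ
open import Data.Integer using (ℤ; +_; 1ℤ; _+_; _-_; _≤_; _<_; _⊔_; _⊓_; ∣_∣; +≤+)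
open import Data.Integer.Properties
open import Data.Integer.Tactic.RingSolver using (solve-∀)
open import Data.Sum using (_⊎_; inj₁; inj₂)
open import Data.Empty using (⊥-elim)
open import Data.List using ([]; _∷_)
open import Data.List.Relation.Unary.Any using (here; there)
open import Data.Product.Properties using (≡-dec)
open import Relation.Nullary using (¬_; yes; no)
open import Relation.Binary.PropositionalEquality using (refl; sym; trans; cong; cong₂; subst)

open import Data.List.Membership.DecPropositional (≡-dec _≟_ _≟_) using (_∈?_)

-- Every point P = (x, y) of S is the union of the lowest point (x, y')
-- of the vertical run of S below P, which lies in B_lower because (x, y' - 1) ∉ S,
-- and the leftmost point (x', y) of the horizontal run of S left of P, which lies
-- in B_upper because (x' - 1, y) ∉ S; finiteness of S makes both runs end.
-- Conversely S is closed under ∪: starting from B ∈ S, axiom (A2) applied to A and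
-- the current point always yields a neighbour one step closer to A ∪ B.

i-[1+n]+1≡i-n : ∀ i n → i - + suc n + 1ℤ ≡ i - + n
i-[1+n]+1≡i-n i n = identity i (+ n)
  where
  identity : ∀ i j → i - (1ℤ + j) + 1ℤ ≡ i - j
  identity = solve-∀

i-[1+n]<i : ∀ i n → i - + suc n < i
i-[1+n]<i i n = suc[i]≤j⇒i<j (subst (_≤ i) (identity i (+ n)) (i-j≤i i (+ n)))
  where
  identity : ∀ i j → i - j ≡ 1ℤ + (i - (1ℤ + j))
  identity = solve-∀

i+[1+n]-1≡i+n : ∀ i n → i + + suc n - 1ℤ ≡ i + + n
i+[1+n]-1≡i+n i n = identity i (+ n)
  where
  identity : ∀ i j → i + (1ℤ + j) - 1ℤ ≡ i + j
  identity = solve-∀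

i≤j⇒i+∣j-i∣≡j : ∀ {i j} → i ≤ j → i + + ∣ j - i ∣ ≡ j
i≤j⇒i+∣j-i∣≡j {i} {j} i≤j = trans (cong (λ k → i + k) (0≤i⇒+∣i∣≡i (i≤j⇒0≤j-i i≤j))) (identity i j)
  where
  identity : ∀ i j → i + (j - i) ≡ j
  identity = solve-∀

i≤j⇒j-∣j-i∣≡i : ∀ {i j} → i ≤ j → j - + ∣ j - i ∣ ≡ i
i≤j⇒j-∣j-i∣≡i {i} {j} i≤j = trans (cong (λ k → j - k) (0≤i⇒+∣i∣≡i (i≤j⇒0≤j-i i≤j))) (identity i j)
  where
  identity : ∀ i j → j - (j - i) ≡ i
  identity = solve-∀

lowerBound : (S : PointSet) → ∃[ lo ] (∀ {x y} → (x , y) ∈ S → lo ≤ x × lo ≤ y)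
lowerBound [] = 1ℤ , λ ()
lowerBound ((a , b) ∷ S) with lowerBound S
... | lo , bound = (a ⊓ b) ⊓ lo , bound′
  where
  bound′ : ∀ {x y} → (x , y) ∈ (a , b) ∷ S → (a ⊓ b) ⊓ lo ≤ x × (a ⊓ b) ⊓ lo ≤ y
  bound′ (here refl) = ≤-trans (i⊓j≤i _ lo) (i⊓j≤i a b) , ≤-trans (i⊓j≤i _ lo) (i⊓j≤j a b)
  bound′ (there p)   = ≤-trans (i⊓j≤j _ lo) (proj₁ (bound p)) , ≤-trans (i⊓j≤j _ lo) (proj₂ (bound p))

module _ {P Q : ℤ → Set} {lo : ℤ} (bounded : ∀ {n} → P n → lo ≤ n)
         (step : ∀ {n} → P n → Q n ⊎ P (n - 1ℤ)) where

  descend-from : ∀ m → P (lo + + m) → ∃[ n ] (n ≤ lo + + m × Q n)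
  descend-from m p with step p
  ... | inj₁ q = _ , ≤-refl , q
  descend-from zero p | inj₂ p′ =
    ⊥-elim (<⇒≱ (i-[1+n]<i lo 0) (bounded (subst (λ n → P (n - 1ℤ)) (+-identityʳ lo) p′)))
  descend-from (suc m) p | inj₂ p′ with descend-from m (subst P (i+[1+n]-1≡i+n lo m) p′)
  ... | n , n≤ , q = n , ≤-trans n≤ (+-monoʳ-≤ lo (+≤+ (ℕ.n≤1+n m))) , q

  descend : ∀ {n} → P n → ∃[ n′ ] (n′ ≤ n × Q n′)
  descend {n} p = subst (λ k → ∃[ n′ ] (n′ ≤ k × Q n′)) n≡ (descend-from _ (subst P (sym n≡) p))
    where
    n≡ : lo + + ∣ n - lo ∣ ≡ n
    n≡ = i≤j⇒i+∣j-i∣≡j (bounded p)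

Blower-below : (S : PointSet) → ∀ {x y} → (x , y) ∈ S → ∃[ y′ ] (y′ ≤ y × Blower S (x , y′))
Blower-below S {x} = descend (λ p → proj₂ (proj₂ (lowerBound S) p)) lowest-or-below
  where
  lowest-or-below : ∀ {y} → (x , y) ∈ S → Blower S (x , y) ⊎ (x , y - 1ℤ) ∈ S
  lowest-or-below {y} p with (x , y - 1ℤ) ∈? S
  ... | yes below = inj₂ below
  ... | no ¬below = inj₁ (p , inj₂ (inj₁ ¬below))

Bupper-leftOf : (S : PointSet) → ∀ {x y} → (x , y) ∈ S → ∃[ x′ ] (x′ ≤ x × Bupper S (x′ , y))
Bupper-leftOf S {y = y} = descend (λ p → proj₁ (proj₂ (lowerBound S) p)) leftmost-or-left
  where
  leftmost-or-left : ∀ {x} → (x , y) ∈ S → Bupper S (x , y) ⊎ (x - 1ℤ , y) ∈ S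
  leftmost-or-left {x} p with (x - 1ℤ , y) ∈? S
  ... | yes left = inj₂ left
  ... | no ¬left = inj₁ (p , inj₁ ¬left)

∈⇒Blower∪Bupper : (S : PointSet) → ∀ {P} → P ∈ S →
                  ∃[ X ] ∃[ Y ] (Blower S X × Bupper S Y × P ≡ X ∪ₚ Y)
∈⇒Blower∪Bupper S {x , y} p with Blower-below S p | Bupper-leftOf S p
... | y′ , y′≤y , lowX | x′ , x′≤x , upY =
  (x , y′) , (x′ , y) , lowX , upY , sym (cong₂ _,_ (i≥j⇒i⊔j≡i x′≤x) (i≤j⇒i⊔j≡j y′≤y))

-- The target t is climbed to from t - m while keeping a ⊔ (t - m) ≡ t, i.e. a ≤ t and (m ≡ 0 or a ≡ t).
module _ {S : PointSet} (a2 : A2 S) {xa ya : ℤ} (A∈S : (xa , ya) ∈ S) where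

  private
    ¬⊆-leftOf : ∀ {m yb} → ¬ ((xa , ya) ⊆ₚ (xa - + suc m , yb))
    ¬⊆-leftOf {m} (xa≤ , _) = <⇒≱ (i-[1+n]<i xa m) xa≤

    ¬⊆-below : ∀ {k xb} → ¬ ((xa , ya) ⊆ₚ (xb , ya - + suc k))
    ¬⊆-below {k} (_ , ya≤) = <⇒≱ (i-[1+n]<i ya k) ya≤

    step-right : ∀ {m yb} → (xa - + suc m + 1ℤ , yb) ∈ S → (xa - + m , yb) ∈ S
    step-right {m} {yb} = subst (_∈ S) (cong (_, yb) (i-[1+n]+1≡i-n xa m))

    step-up : ∀ {k xb} → (xb , ya - + suc k + 1ℤ) ∈ S → (xb , ya - + k) ∈ S
    step-up {k} {xb} = subst (_∈ S) (cong (xb ,_) (i-[1+n]+1≡i-n ya k))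

    i≤j⇒i≤j-0 : ∀ {i j} → i ≤ j → i ≤ j - + 0
    i≤j⇒i≤j-0 {j = j} = subst (_ ≤_) (sym (+-identityʳ j))

  climb : ∀ {tx ty} m k → (m ≡ 0 ⊎ xa ≡ tx) → (k ≡ 0 ⊎ ya ≡ ty) → xa ≤ tx → ya ≤ ty →
          (tx - + m , ty - + k) ∈ S → (tx , ty) ∈ S
  climb {tx} {ty} zero zero _ _ _ _ B∈S =
    subst (_∈ S) (cong₂ _,_ (+-identityʳ tx) (+-identityʳ ty)) B∈S
  climb (suc m) _ (inj₁ ()) _ _ _ _
  climb zero (suc k) _ (inj₁ ()) _ _ _
  climb (suc m) zero (inj₂ refl) _ _ ya≤ty B∈S =
    climb m zero (inj₂ refl) (inj₁ refl) ≤-refl ya≤ty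
      (step-right (proj₂ (proj₂ (a2 _ _ _ _ A∈S B∈S ¬⊆-leftOf)) (i-j≤i xa (+ suc m)) (i≤j⇒i≤j-0 ya≤ty)))
  climb zero (suc k) mx (inj₂ refl) xa≤tx _ B∈S =
    climb zero k mx (inj₂ refl) xa≤tx ≤-refl
      (step-up (proj₁ (proj₂ (a2 _ _ _ _ A∈S B∈S ¬⊆-below)) (i≤j⇒i≤j-0 xa≤tx) (i-j≤i ya (+ suc k))))
  climb (suc m) (suc k) (inj₂ refl) (inj₂ refl) _ _ B∈S
    with proj₁ (a2 _ _ _ _ A∈S B∈S ¬⊆-leftOf) (i-j≤i xa (+ suc m)) (i-j≤i ya (+ suc k))
  ... | inj₁ right = climb m (suc k) (inj₂ refl) (inj₂ refl) ≤-refl ≤-refl (step-right right)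
  ... | inj₂ up    = climb (suc m) k (inj₂ refl) (inj₂ refl) ≤-refl ≤-refl (step-up up)

gap-below-⊔ : ∀ a b → ∃[ m ] (b ≡ (a ⊔ b) - + m × (m ≡ 0 ⊎ a ≡ a ⊔ b))
gap-below-⊔ a b with ≤-total a b
... | inj₁ a≤b rewrite i≤j⇒i⊔j≡j a≤b = 0 , sym (+-identityʳ b) , inj₁ refl
... | inj₂ b≤a rewrite i≥j⇒i⊔j≡i b≤a = ∣ a - b ∣ , sym (i≤j⇒j-∣j-i∣≡i b≤a) , inj₂ refl

∪ₚ-closed : ∀ {S} → A2 S → ∀ {A B} → A ∈ S → B ∈ S → A ∪ₚ B ∈ S
∪ₚ-closed {S} a2 {xa , ya} {xb , yb} A∈S B∈S
  with gap-below-⊔ xa xb | gap-below-⊔ ya yb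
... | m , xb≡ , mx | k , yb≡ , ky =
  climb a2 A∈S m k mx ky (i≤i⊔j xa xb) (i≤i⊔j ya yb) (subst (_∈ S) (cong₂ _,_ xb≡ yb≡) B∈S)

corollary1 : (S : PointSet) → IsAntimatroidal S →
  ∀ (P : Point) →
    ((P ∈ S) → ∃[ X ] ∃[ Y ] (Blower S X × Bupper S Y × P ≡ X ∪ₚ Y))
    × ((∃[ X ] ∃[ Y ] (Blower S X × Bupper S Y × P ≡ X ∪ₚ Y)) → P ∈ S)
corollary1 S (_ , _ , a2) P =
  ∈⇒Blower∪Bupper S ,
  λ { (X , Y , (X∈S , _) , (Y∈S , _) , refl) → ∪ₚ-closed a2 X∈S Y∈S }
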